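{- If $\dot G\in\mathcal{C}_1\cup\mathcal{C}_4\cup\mathcal{C}_5$ is a connected, non-complete, $5$-regular and $1$ net-regular strongly regular signed graph with parameters $(n,5,a,b,c)$, then $(a,b)\neq(0,2)$ and $(a,b)\neq(-2,0)$.
   Context: A signed graph $\dot G=(G,\sigma)$ is a simple graph $G$ (its underlying graph) with a sign function $\sigma:E(G)\to\{+1,-1\}$; its adjacency matrix $A_{\dot G}$ has $(i,j)$ entry $\sigma(v_iv_j)$ if $v_i\sim v_j$ and $0$ otherwise. Degree is the degree in $G$; $d^\pm(v)$ are the numbers of positive/negative edges at $v$; the net-degree is $d^+(v)-d^-(v)$, and $\dot G$ is $\rho$ net-regular if all net-degrees equal $\rho$. Connected/complete refer to $G$. $\dot G$ is homogeneous if all edges have the same sign, inhomogeneous otherwise. A signed graph on $n$ vertices is strongly regular (SRSG) if it is neither homogeneous complete nor edgeless and there are $r\in\mathbb N$, $a,b,c\in\mathbb Z$ with $(A^2_{\dot G})_{ii}=r$, $(A^2_{\dot G})_{ij}=a$ for positive edges $v_iv_j$, $=b$ for negative edges, $=c$ for distinct non-adjacent $v_i,v_j$; parameters $(n,r,a,b,c)$. Inhomogeneous SRSGs are divided into classes: $\mathcal{C}_1$: $a=-b$, and either complete or non-complete with $c\neq 0$; $\mathcal{C}_4$: $a\neq -b$, non-complete with $c=0$; $\mathcal{C}_5$: $a\ne -b$, non-complete with $c\neq\frac{a+b}{2}$ and $c\neq 0$. -}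

module Defs where

open import Data.Nat using (ℕ; zero; suc)
open import Data.Integer using (ℤ; +_; -_; _+_; _*_; ∣_∣)
open import Data.Fin using (Fin; zero; suc)
open import Data.Product using (_×_; Σ)
open import Data.Sum using (_⊎_)
open import Relation.Nullary using (¬_)
open import Relation.Binary.PropositionalEquality using (_≡_; _≢_)

sumFin : ∀ {n} → (Fin n → ℤ) → ℤ
sumFin {zero}  f = + 0
sumFin {suc n} f = f zero + sumFin (λ k → f (suc k))

record SignedGraph (n : ℕ) : Set where
  field
    A     : Fin n → Fin n → ℤ
    entry : ∀ i j → A i j ≡ + 0 ⊎ A i j ≡ + 1 ⊎ A i j ≡ - (+ 1)
    symm  : ∀ i j → A i j ≡ A j i
    loopless : ∀ i → A i i ≡ + 0
open SignedGraph public

module _ {n : ℕ} (G : SignedGraph n) where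

  A² : Fin n → Fin n → ℤ
  A² i j = sumFin (λ k → A G i k * A G k j)

  Adjacent : Fin n → Fin n → Set
  Adjacent i j = A G i j ≢ + 0

  PositiveEdge : Fin n → Fin n → Set
  PositiveEdge i j = A G i j ≡ + 1

  NegativeEdge : Fin n → Fin n → Set
  NegativeEdge i j = A G i j ≡ - (+ 1)

  degree : Fin n → ℕ
  degree i = ∣ sumFin (λ k → + ∣ A G i k ∣) ∣

  netDegree : Fin n → ℤ
  netDegree i = sumFin (λ k → A G i k)

  Regular : ℕ → Set
  Regular r = ∀ i → degree i ≡ r

  NetRegular : ℤ → Set
  NetRegular ρ = ∀ i → netDegree i ≡ ρ

  data Walk : Fin n → Fin n → Set where
    here : ∀ {i} → Walk i i
    step : ∀ {i j k} → Adjacent i j → Walk j k → Walk i k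

  Connected : Set
  Connected = ∀ i j → Walk i j

  Complete : Set
  Complete = ∀ i j → i ≢ j → Adjacent i j

  Edgeless : Set
  Edgeless = ∀ i j → A G i j ≡ + 0

  Homogeneous : Set
  Homogeneous = (∀ i j → ¬ NegativeEdge i j) ⊎ (∀ i j → ¬ PositiveEdge i j)

  Inhomogeneous : Set
  Inhomogeneous = ¬ Homogeneous

  record StronglyRegular (r : ℕ) (a b c : ℤ) : Set where
    field
      notHomComplete : ¬ (Homogeneous × Complete)
      notEdgeless    : ¬ Edgeless
      diag  : ∀ i → A² i i ≡ + r
      pos   : ∀ i j → PositiveEdge i j → A² i j ≡ a
      neg   : ∀ i j → NegativeEdge i j → A² i j ≡ b
      nonadj : ∀ i j → i ≢ j → A G i j ≡ + 0 → A² i j ≡ c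

  -- classes of inhomogeneous SRSGs (c ≠ (a+b)/2 is written 2c ≠ a+b)
  Class₁ : ℤ → ℤ → ℤ → Set
  Class₁ a b c = Inhomogeneous × a ≡ - b × (Complete ⊎ (¬ Complete × c ≢ + 0))

  Class₄ : ℤ → ℤ → ℤ → Set
  Class₄ a b c = Inhomogeneous × a ≢ - b × ¬ Complete × c ≡ + 0

  Class₅ : ℤ → ℤ → ℤ → Set
  Class₅ a b c = Inhomogeneous × a ≢ - b × ¬ Complete
                 × (+ 2) * c ≢ a + b × c ≢ + 0

-- Fix a vertex i. Being 5-regular and 1-net-regular, i has three positive and two negative
-- neighbours; let L be the signed graph they induce and D = Σᵤᵥ σᵤ σᵥ Lᵤᵥ², where σᵤ is the sign
-- of the edge from i to u. Evaluating (A⁴)ᵢᵢ = Σⱼ (A²)ᵢⱼ² once from the parameters (the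
-- non-neighbours are eliminated with Σⱼ (A²)ᵢⱼ = 1) and once through the entries (A²)ᵤᵥ between
-- neighbours, which are affine in Lᵤᵥ and Lᵤᵥ², gives (a + b − 2c)(D − 3a − 2b) = 0. Both excluded
-- pairs have a ≠ −b, so G lies in 𝒞₄ or 𝒞₅, where 2c ≠ a + b; hence D = 3a + 2b. An exhaustive
-- search over the 3¹⁰ candidates for L, constrained by (A²)ᵢᵥ ∈ {a, b} at the neighbours v and by
-- each neighbour having only three positive edges, finds none with D = 3a + 2b.

module Submission where

open import Defs
open import Data.Nat using (ℕ; zero; suc; z≤n)
import Data.Nat as ℕ
open import Data.Integer
  using (ℤ; +_; -_; -[1+_]; _+_; _-_; _*_; ∣_∣; _≤_; _≤ᵇ_; +≤+; 0ℤ; 1ℤ; -1ℤ)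
open import Data.Integer.Properties
  using ( +-*-semiring; *-commutativeSemigroup; _≟_; ≤-refl; ≤-reflexive; ≤-trans; +-mono-≤
        ; +-identityˡ; +-identityʳ; +-inverseʳ; +-assoc; *-identityˡ; *-identityʳ; *-zeroʳ
        ; *-distribˡ-+; *-distribʳ-+; *-assoc; *-comm; suc-*; -1*i≡-i; neg-involutive
        ; 0≤i⇒+∣i∣≡i; ≤⇒≤ᵇ; i-j≡0⇒i≡j; i*j≡0⇒i≡0∨j≡0)
open import Data.Integer.Tactic.RingSolver using (solve-∀)
open import Algebra.Properties.Semiring.Sum +-*-semiring
  using (sum; sum-cong-≗; sum-replicate-zero; ∑-distrib-+; ∑-comm; *-distribˡ-sum; *-distribʳ-sum)
open import Algebra.Properties.CommutativeSemigroup *-commutativeSemigroup using (x∙yz≈y∙xz)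
open import Data.Fin using (Fin; zero; suc)
open import Data.Fin.Patterns using (0F; 1F; 2F; 3F; 4F)
import Data.Fin.Properties as Fin
open import Data.Bool using (Bool; true; false; T; _∧_; if_then_else_)
open import Data.Bool.Properties using (T-∧; T-≡)
open import Data.Bool.ListAction using (all)
open import Data.List using (List; []; _∷_; _++_; map; length)
import Data.List as List
open import Data.List.Relation.Unary.All as All using (All; []; _∷_)
open import Data.List.Relation.Unary.All.Properties using (all⁺) renaming (map⁺ to All-map⁺)
open import Data.List.Relation.Unary.Any using (here; there)
open import Data.List.Relation.Unary.AllPairs using ([]; _∷_)
open import Data.List.Relation.Unary.Unique.Propositional using (Unique)
import Data.List.Relation.Unary.Unique.Propositional.Properties as Unique
open import Data.List.Membership.Propositional using (_∈_)
open import Data.List.Membership.Propositional.Properties using (∈-lookup)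
open import Data.Vec using (Vec; []; _∷_; lookup; replicate) renaming (_++_ to _++ᵛ_)
import Data.Vec.Relation.Unary.All as Vec
open import Data.Product using (_×_; _,_; proj₁; proj₂)
open import Data.Sum using (_⊎_; inj₁; inj₂)
open import Data.Empty using (⊥-elim)
open import Function using (_∘_; id; Equivalence)
open import Relation.Nullary using (¬_; Dec; does; yes; no; contradiction; isYes; isNo)
open import Relation.Nullary.Decidable using (dec-true; dec-false; fromWitness; toWitnessFalse)
open import Relation.Binary.PropositionalEquality
  using (_≡_; _≢_; refl; sym; trans; cong; cong₂; subst; module ≡-Reasoning)

open ≡-Reasoning

-- Finite sums and quadratic forms

sumFin≡sum : ∀ {n} (f : Fin n → ℤ) → sumFin f ≡ sum f
sumFin≡sum {zero}  f = refl
sumFin≡sum {suc n} f = cong (_+_ (f zero)) (sumFin≡sum (f ∘ suc))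

sum-mono-≤ : ∀ {n} {f g : Fin n → ℤ} → (∀ k → f k ≤ g k) → sum f ≤ sum g
sum-mono-≤ {zero}  f≤g = ≤-refl
sum-mono-≤ {suc n} f≤g = +-mono-≤ (f≤g zero) (sum-mono-≤ (f≤g ∘ suc))

δ : ∀ {n} → Fin n → Fin n → ℤ
δ i k = if does (i Fin.≟ k) then 1ℤ else 0ℤ

δ-diag : ∀ {n} (i : Fin n) → δ i i ≡ 1ℤ
δ-diag i rewrite dec-true (i Fin.≟ i) refl = refl

δ-off : ∀ {n} {i k : Fin n} → i ≢ k → δ i k ≡ 0ℤ
δ-off {i = i} {k} i≢k rewrite dec-false (i Fin.≟ k) i≢k = refl

sum-δ : ∀ {n} (i : Fin n) (h : Fin n → ℤ) → sum (λ k → δ i k * h k) ≡ h i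
sum-δ {suc n} zero    h = trans (cong₂ _+_ (*-identityˡ (h zero)) (sum-replicate-zero n)) (+-identityʳ _)
sum-δ {suc n} (suc i) h = trans (+-identityˡ _) (sum-δ i (h ∘ suc))

dot : ∀ {m} → (Fin m → ℤ) → (Fin m → ℤ) → ℤ
dot s h = sum (λ v → s v * h v)

dot-+ : ∀ {m} (s f g : Fin m → ℤ) → dot s (λ v → f v + g v) ≡ dot s f + dot s g
dot-+ s f g = trans (sum-cong-≗ (λ v → *-distribˡ-+ (s v) (f v) (g v))) (∑-distrib-+ (λ v → s v * f v) (λ v → s v * g v))

dot-* : ∀ {m} (s f : Fin m → ℤ) x → dot s (λ v → x * f v) ≡ x * dot s f
dot-* s f x = trans (sum-cong-≗ (λ v → x∙yz≈y∙xz (s v) x (f v))) (sym (*-distribˡ-sum x (λ v → s v * f v)))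

quadForm : ∀ {m} → (Fin m → ℤ) → (Fin m → Fin m → ℤ) → ℤ
quadForm s X = dot s (λ u → dot s (X u))

quadForm-cong : ∀ {m} (s : Fin m → ℤ) {X Y : Fin m → Fin m → ℤ} →
                (∀ u v → X u v ≡ Y u v) → quadForm s X ≡ quadForm s Y
quadForm-cong s X≡Y = sum-cong-≗ (λ u → cong (s u *_) (sum-cong-≗ (λ v → cong (s v *_) (X≡Y u v))))

quadForm-+ : ∀ {m} (s : Fin m → ℤ) (X Y : Fin m → Fin m → ℤ) →
             quadForm s (λ u v → X u v + Y u v) ≡ quadForm s X + quadForm s Y
quadForm-+ s X Y = trans (sum-cong-≗ (λ u → cong (s u *_) (dot-+ s (X u) (Y u)))) (dot-+ s _ _)

quadForm-* : ∀ {m} (s : Fin m → ℤ) (X : Fin m → Fin m → ℤ) x →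
             quadForm s (λ u v → x * X u v) ≡ x * quadForm s X
quadForm-* s X x = trans (sum-cong-≗ (λ u → cong (s u *_) (dot-* s (X u) x))) (dot-* s _ x)

-- Splitting a sum by the signs of a vector

IsSign : ℤ → Set
IsSign z = z ≡ 0ℤ ⊎ z ≡ 1ℤ ⊎ z ≡ -1ℤ

sumOver : ∀ {a} {X : Set a} → (X → ℤ) → List X → ℤ
sumOver h []       = 0ℤ
sumOver h (x ∷ xs) = h x + sumOver h xs

module _ {a b} {X : Set a} {Y : Set b} where

  sumOver-map : ∀ (h : Y → ℤ) (g : X → Y) xs → sumOver h (map g xs) ≡ sumOver (h ∘ g) xs
  sumOver-map h g []       = refl
  sumOver-map h g (x ∷ xs) = cong (_+_ (h (g x))) (sumOver-map h g xs)

module _ {a} {X : Set a} where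

  sumOver-++ : ∀ (h : X → ℤ) xs ys → sumOver h (xs ++ ys) ≡ sumOver h xs + sumOver h ys
  sumOver-++ h []       ys = sym (+-identityˡ _)
  sumOver-++ h (x ∷ xs) ys = trans (cong (_+_ (h x)) (sumOver-++ h xs ys)) (sym (+-assoc (h x) _ _))

  sumOver-const : ∀ {h : X → ℤ} {xs} z → All (λ x → h x ≡ z) xs → sumOver h xs ≡ + length xs * z
  sumOver-const z []                         = refl
  sumOver-const {xs = _ ∷ xs} z (hx≡z ∷ hxs≡z) =
    trans (cong₂ _+_ hx≡z (sumOver-const z hxs≡z)) (sym (suc-* (+ length xs) z))

  lookup-injective : ∀ {xs : List X} → Unique xs → ∀ i j → List.lookup xs i ≡ List.lookup xs j → i ≡ j
  lookup-injective (x∉xs ∷ _)  zero    zero    _  = refl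
  lookup-injective (x∉xs ∷ _)  zero    (suc j) eq = contradiction eq (All.lookup x∉xs (∈-lookup j))
  lookup-injective (x∉xs ∷ _)  (suc i) zero    eq = contradiction (sym eq) (All.lookup x∉xs (∈-lookup i))
  lookup-injective (_ ∷ uniq) (suc i) (suc j) eq = cong suc (lookup-injective uniq i j eq)

indicesOf : ∀ {n} → ℤ → (Fin n → ℤ) → List (Fin n)
indicesOf {zero}  v f = []
indicesOf {suc n} v f = if does (f zero ≟ v) then zero ∷ rest else rest
  where rest = map suc (indicesOf v (f ∘ suc))

indicesOf-All : ∀ {n} v (f : Fin n → ℤ) → All (λ k → f k ≡ v) (indicesOf v f)
indicesOf-All {zero}  v f = []
indicesOf-All {suc n} v f with f zero ≟ v
... | yes f₀≡v = f₀≡v ∷ All-map⁺ (indicesOf-All v (f ∘ suc))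
... | no  _    = All-map⁺ (indicesOf-All v (f ∘ suc))

indicesOf-Unique : ∀ {n} v (f : Fin n → ℤ) → Unique (indicesOf v f)
indicesOf-Unique {zero}  v f = []
indicesOf-Unique {suc n} v f with does (f zero ≟ v)
... | true  = All-map⁺ (All.universal (λ _ ()) _) ∷ Unique.map⁺ Fin.suc-injective (indicesOf-Unique v (f ∘ suc))
... | false = Unique.map⁺ Fin.suc-injective (indicesOf-Unique v (f ∘ suc))

sumOver-indicesOf : ∀ {n} (h : Fin (suc n) → ℤ) v f →
  sumOver h (indicesOf v f) ≡ (if does (f zero ≟ v) then h zero else 0ℤ) + sumOver (h ∘ suc) (indicesOf v (f ∘ suc))
sumOver-indicesOf h v f with does (f zero ≟ v)
... | true  = cong (_+_ (h zero)) (sumOver-map h suc (indicesOf v (f ∘ suc)))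
... | false = trans (sumOver-map h suc (indicesOf v (f ∘ suc))) (sym (+-identityˡ _))

sum-bySign : ∀ {n} (f h : Fin n → ℤ) → (∀ k → IsSign (f k)) → (∀ k → f k ≡ 0ℤ → h k ≡ 0ℤ) →
             sum h ≡ sumOver h (indicesOf 1ℤ f) + sumOver h (indicesOf -1ℤ f)
sum-bySign {zero}  f h sign vanish = refl
sum-bySign {suc n} f h sign vanish = begin
  h zero + sum (h ∘ suc)                   ≡⟨ cong₂ _+_ h₀-split (sum-bySign (f ∘ suc) (h ∘ suc) (sign ∘ suc) (vanish ∘ suc)) ⟩
  (c⁺ + c⁻) + (S⁺ + S⁻)                     ≡⟨ regroup c⁺ c⁻ S⁺ S⁻ ⟩
  (c⁺ + S⁺) + (c⁻ + S⁻)                     ≡⟨ sym (cong₂ _+_ (sumOver-indicesOf h 1ℤ f) (sumOver-indicesOf h -1ℤ f)) ⟩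
  sumOver h (indicesOf 1ℤ f) + sumOver h (indicesOf -1ℤ f) ∎
  where
  at : ℤ → ℤ
  at v = if does (f zero ≟ v) then h zero else 0ℤ
  c⁺ = at 1ℤ
  c⁻ = at -1ℤ
  S⁺ = sumOver (h ∘ suc) (indicesOf 1ℤ (f ∘ suc))
  S⁻ = sumOver (h ∘ suc) (indicesOf -1ℤ (f ∘ suc))
  regroup : ∀ w x y z → (w + x) + (y + z) ≡ (w + y) + (x + z)
  regroup = solve-∀
  h₀-split : h zero ≡ at 1ℤ + at -1ℤ
  h₀-split with sign zero
  ... | inj₁ f₀≡0        rewrite f₀≡0  = vanish zero f₀≡0
  ... | inj₂ (inj₁ f₀≡1) rewrite f₀≡1  = sym (+-identityʳ _)
  ... | inj₂ (inj₂ f₀≡-1) rewrite f₀≡-1 = sym (+-identityˡ _)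

-- Powers of the adjacency matrix

twicePositivePart : ℤ → ℤ
twicePositivePart z = + ∣ z ∣ + z

twicePositivePart-nonneg : ∀ z → 0ℤ ≤ twicePositivePart z
twicePositivePart-nonneg (+ m)    = +≤+ z≤n
twicePositivePart-nonneg -[1+ m ] = ≤-reflexive (sym (+-inverseʳ (+ suc m)))

module _ {n} (G : SignedGraph n) where

  A²≡sum : ∀ i j → A² G i j ≡ sum (λ k → A G i k * A G k j)
  A²≡sum i j = sumFin≡sum (λ k → A G i k * A G k j)

  sum-A²-row : ∀ {ρ} → NetRegular G ρ → ∀ i → sum (A² G i) ≡ ρ * ρ
  sum-A²-row {ρ} netRegular i = begin
    sum (A² G i)                                ≡⟨ sum-cong-≗ (A²≡sum i) ⟩
    sum (λ j → sum (λ k → A G i k * A G k j))   ≡⟨ ∑-comm (λ j k → A G i k * A G k j) ⟩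
    sum (λ k → sum (λ j → A G i k * A G k j))   ≡⟨ sum-cong-≗ (λ k → sym (*-distribˡ-sum (A G i k) (A G k))) ⟩
    sum (λ k → A G i k * sum (A G k))           ≡⟨ sum-cong-≗ (λ k → cong (A G i k *_) (row k)) ⟩
    sum (λ k → A G i k * ρ)                     ≡⟨ sym (*-distribʳ-sum ρ (A G i)) ⟩
    sum (A G i) * ρ                             ≡⟨ cong (_* ρ) (row i) ⟩
    ρ * ρ ∎
    where
    row : ∀ k → sum (A G k) ≡ ρ
    row k = trans (sym (sumFin≡sum (A G k))) (netRegular k)

  -- Both sides are (A⁴)ᵢᵢ.
  sum-A²-squares : ∀ i → sum (λ j → A² G i j * A² G i j) ≡ sum (λ k → A G i k * sum (λ l → A G i l * A² G k l))
  sum-A²-squares i = begin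
    sum (λ j → Aᵢ² j * Aᵢ² j)                                    ≡⟨ sum-cong-≗ (λ j → cong (_* Aᵢ² j) (A²≡sum i j)) ⟩
    sum (λ j → sum (λ k → A G i k * A G k j) * Aᵢ² j)          ≡⟨ sum-cong-≗ (λ j → *-distribʳ-sum (Aᵢ² j) (λ k → A G i k * A G k j)) ⟩
    sum (λ j → sum (λ k → A G i k * A G k j * Aᵢ² j))          ≡⟨ ∑-comm (λ j k → A G i k * A G k j * Aᵢ² j) ⟩
    sum (λ k → sum (λ j → A G i k * A G k j * Aᵢ² j))          ≡⟨ sum-cong-≗ (λ k → trans (sum-cong-≗ (λ j → *-assoc (A G i k) (A G k j) (Aᵢ² j)))
                                                                                       (sym (*-distribˡ-sum (A G i k) (λ j → A G k j * Aᵢ² j)))) ⟩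
    sum (λ k → A G i k * sum (λ j → A G k j * Aᵢ² j))          ≡⟨ sum-cong-≗ (λ k → cong (A G i k *_) (A*A² k)) ⟩
    sum (λ k → A G i k * sum (λ l → A G i l * A² G k l)) ∎
    where
    Aᵢ² = A² G i
    A*A² : ∀ k → sum (λ j → A G k j * Aᵢ² j) ≡ sum (λ l → A G i l * A² G k l)
    A*A² k = begin
      sum (λ j → A G k j * Aᵢ² j)                              ≡⟨ sum-cong-≗ (λ j → cong (A G k j *_) (A²≡sum i j)) ⟩
      sum (λ j → A G k j * sum (λ l → A G i l * A G l j))    ≡⟨ sum-cong-≗ (λ j → *-distribˡ-sum (A G k j) (λ l → A G i l * A G l j)) ⟩
      sum (λ j → sum (λ l → A G k j * (A G i l * A G l j)))  ≡⟨ ∑-comm (λ j l → A G k j * (A G i l * A G l j)) ⟩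
      sum (λ l → sum (λ j → A G k j * (A G i l * A G l j)))  ≡⟨ sum-cong-≗ (λ l → sum-cong-≗ (λ j → trans (x∙yz≈y∙xz (A G k j) (A G i l) (A G l j))
                                                                                   (cong (λ z → A G i l * (A G k j * z)) (symm G l j)))) ⟩
      sum (λ l → sum (λ j → A G i l * (A G k j * A G j l)))  ≡⟨ sum-cong-≗ (λ l → sym (*-distribˡ-sum (A G i l) (λ j → A G k j * A G j l))) ⟩
      sum (λ l → A G i l * sum (λ j → A G k j * A G j l))    ≡⟨ sum-cong-≗ (λ l → cong (A G i l *_) (sym (A²≡sum k l))) ⟩
      sum (λ l → A G i l * A² G k l) ∎

  sum-abs≡degree : ∀ v → sum (λ k → + ∣ A G v k ∣) ≡ + degree G v
  sum-abs≡degree v = begin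
    sum absRow             ≡⟨ 0≤i⇒+∣i∣≡i absRow≥0 ⟨
    + ∣ sum absRow ∣       ≡⟨ cong (λ s → + ∣ s ∣) (sumFin≡sum absRow) ⟨
    + degree G v ∎
    where
    absRow : Fin n → ℤ
    absRow k = + ∣ A G v k ∣
    absRow≥0 : 0ℤ ≤ sum absRow
    absRow≥0 = subst (_≤ sum absRow) (sum-replicate-zero n) (sum-mono-≤ {f = λ _ → 0ℤ} {absRow} (λ _ → +≤+ z≤n))

  sum-twicePositivePart : ∀ {r ρ} → Regular G r → NetRegular G ρ → ∀ v →
                          sum (λ k → twicePositivePart (A G v k)) ≡ + r + ρ
  sum-twicePositivePart regular netRegular v =
    trans (∑-distrib-+ (λ k → + ∣ A G v k ∣) (A G v))
          (cong₂ _+_ (trans (sum-abs≡degree v) (cong +_ (regular v))) (trans (sym (sumFin≡sum (A G v))) (netRegular v)))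

edgeValue : ℤ → ℤ → ℤ → ℤ → ℤ
edgeValue a b c (+ 0) = c
edgeValue a b c (+ 1) = a
edgeValue a b c _     = b

twice-edgeValue : ∀ a b c {z} → IsSign z →
                  + 2 * edgeValue a b c z ≡ + 2 * c + (a + b - + 2 * c) * (z * z) + (a - b) * z
twice-edgeValue a b c (inj₁ refl)        = zero-case a b c
  where zero-case : ∀ a b c → + 2 * c ≡ + 2 * c + (a + b - + 2 * c) * (0ℤ * 0ℤ) + (a - b) * 0ℤ
        zero-case = solve-∀
twice-edgeValue a b c (inj₂ (inj₁ refl)) = plus-case a b c
  where plus-case : ∀ a b c → + 2 * a ≡ + 2 * c + (a + b - + 2 * c) * (1ℤ * 1ℤ) + (a - b) * 1ℤ
        plus-case = solve-∀
twice-edgeValue a b c (inj₂ (inj₂ refl)) = minus-case a b c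
  where minus-case : ∀ a b c → + 2 * b ≡ + 2 * c + (a + b - + 2 * c) * (-1ℤ * -1ℤ) + (a - b) * -1ℤ
        minus-case = solve-∀

module _ {n} {G : SignedGraph n} {r a b c} (srg : StronglyRegular G r a b c) where
  open StronglyRegular srg

  A²-offDiagonal : ∀ {i j} → i ≢ j → A² G i j ≡ edgeValue a b c (A G i j)
  A²-offDiagonal {i} {j} i≢j with entry G i j
  ... | inj₁ A≡0         = trans (nonadj i j i≢j A≡0) (cong (edgeValue a b c) (sym A≡0))
  ... | inj₂ (inj₁ A≡1)  = trans (pos i j A≡1) (cong (edgeValue a b c) (sym A≡1))
  ... | inj₂ (inj₂ A≡-1) = trans (neg i j A≡-1) (cong (edgeValue a b c) (sym A≡-1))

-- Neighbourhoods in 5-regular, 1-net-regular signed graphs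

positive-negative-counts : ∀ p q → p ℕ.+ q ≡ 5 → + p - + q ≡ 1ℤ → p ≡ 3 × q ≡ 2
positive-negative-counts 0 .5 refl ()
positive-negative-counts 1 .4 refl ()
positive-negative-counts 2 .3 refl ()
positive-negative-counts 3 .2 refl refl = refl , refl
positive-negative-counts 4 .1 refl ()
positive-negative-counts 5 .0 refl ()

-- Signs of the edges from a vertex to its five neighbours, positive ones listed first.
σ : Fin 5 → ℤ
σ = lookup (1ℤ ∷ 1ℤ ∷ 1ℤ ∷ -1ℤ ∷ -1ℤ ∷ [])

σ-abs : ∀ u → + ∣ σ u ∣ ≡ 1ℤ
σ-abs = λ { 0F → refl ; 1F → refl ; 2F → refl ; 3F → refl ; 4F → refl }

quadForm-σ-const : ∀ x → quadForm σ (λ _ _ → x) ≡ x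
quadForm-σ-const x = begin
  quadForm σ (λ _ _ → x)         ≡⟨ quadForm-cong σ (λ _ _ → *-identityʳ x) ⟨
  quadForm σ (λ _ _ → x * 1ℤ)    ≡⟨ quadForm-* σ (λ _ _ → 1ℤ) x ⟩
  x * 1ℤ                          ≡⟨ *-identityʳ x ⟩
  x ∎

record Neighbourhood {n} (G : SignedGraph n) (i : Fin n) : Set where
  field
    nb           : Fin 5 → Fin n
    nb-injective : ∀ {u v} → nb u ≡ nb v → u ≡ v
    nb-sign      : ∀ u → A G i (nb u) ≡ σ u
    sum-nb       : ∀ h → (∀ k → A G i k ≡ 0ℤ → h k ≡ 0ℤ) → sum h ≡ sum (h ∘ nb)

module _ {n} (G : SignedGraph n) (regular : Regular G 5) (netRegular : NetRegular G 1ℤ) where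

  private
    fromLists : ∀ {i} (P N : List (Fin n)) → length P ≡ 3 → length N ≡ 2 →
                All (λ k → A G i k ≡ 1ℤ) P → All (λ k → A G i k ≡ -1ℤ) N → Unique (P ++ N) →
                (∀ h → (∀ k → A G i k ≡ 0ℤ → h k ≡ 0ℤ) → sum h ≡ sumOver h (P ++ N)) →
                Neighbourhood G i
    fromLists (p₀ ∷ p₁ ∷ p₂ ∷ []) (q₀ ∷ q₁ ∷ []) refl refl (s₀ ∷ s₁ ∷ s₂ ∷ []) (t₀ ∷ t₁ ∷ []) unique split =
      record
        { nb           = List.lookup (p₀ ∷ p₁ ∷ p₂ ∷ q₀ ∷ q₁ ∷ [])
        ; nb-injective = lookup-injective unique _ _
        ; nb-sign      = λ { 0F → s₀ ; 1F → s₁ ; 2F → s₂ ; 3F → t₀ ; 4F → t₁ }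
        ; sum-nb       = split
        }

  neighbourhood : ∀ i → Neighbourhood G i
  neighbourhood i =
    fromLists P N (proj₁ counts) (proj₂ counts) P-sign N-sign
      (Unique.++⁺ (indicesOf-Unique 1ℤ f) (indicesOf-Unique -1ℤ f) disjoint)
      (λ h vanish → trans (sum-bySign f h sign vanish) (sym (sumOver-++ h P N)))
    where
    f = A G i
    P = indicesOf 1ℤ f
    N = indicesOf -1ℤ f
    sign : ∀ k → IsSign (f k)
    sign = entry G i
    P-sign = indicesOf-All 1ℤ f
    N-sign = indicesOf-All -1ℤ f
    disjoint : ∀ {k} → ¬ (k ∈ P × k ∈ N)
    disjoint (k∈P , k∈N) with trans (sym (All.lookup P-sign k∈P)) (All.lookup N-sign k∈N)
    ... | ()
    abs-split : sumFin (λ k → + ∣ f k ∣) ≡ + (length P ℕ.+ length N)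
    abs-split = begin
      sumFin (λ k → + ∣ f k ∣)                 ≡⟨ sumFin≡sum (λ k → + ∣ f k ∣) ⟩
      sum (λ k → + ∣ f k ∣)                    ≡⟨ sum-bySign f _ sign (λ k f≡0 → cong (λ z → + ∣ z ∣) f≡0) ⟩
      sumOver _ P + sumOver _ N                ≡⟨ cong₂ _+_ (sumOver-const 1ℤ (All.map (cong (λ z → + ∣ z ∣)) P-sign))
                                                              (sumOver-const 1ℤ (All.map (cong (λ z → + ∣ z ∣)) N-sign)) ⟩
      + length P * 1ℤ + + length N * 1ℤ       ≡⟨ cong₂ _+_ (*-identityʳ (+ length P)) (*-identityʳ (+ length N)) ⟩
      + (length P ℕ.+ length N) ∎
    signed-split : sumFin f ≡ + length P - + length N
    signed-split = begin
      sumFin f                                 ≡⟨ sumFin≡sum f ⟩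
      sum f                                    ≡⟨ sum-bySign f f sign (λ k → id) ⟩
      sumOver f P + sumOver f N                ≡⟨ cong₂ _+_ (sumOver-const 1ℤ P-sign) (sumOver-const -1ℤ N-sign) ⟩
      + length P * 1ℤ + + length N * -1ℤ      ≡⟨ cong₂ _+_ (*-identityʳ (+ length P)) (trans (*-comm (+ length N) -1ℤ) (-1*i≡-i (+ length N))) ⟩
      + length P - + length N ∎
    counts : length P ≡ 3 × length N ≡ 2
    counts = positive-negative-counts (length P) (length N)
               (trans (cong ∣_∣ (sym abs-split)) (regular i)) (trans (sym signed-split) (netRegular i))

module NeighbourhoodSums {n} {G : SignedGraph n} {i} (N : Neighbourhood G i) where
  open Neighbourhood N

  i≢nb : ∀ u → i ≢ nb u
  i≢nb u i≡nb with trans (sym (σ-abs u)) (cong (λ z → + ∣ z ∣) (trans (sym (nb-sign u)) (trans (cong (A G i) (sym i≡nb)) (loopless G i))))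
  ... | ()

  sum-A* : ∀ h → sum (λ k → A G i k * h k) ≡ dot σ (h ∘ nb)
  sum-A* h = trans (sum-nb _ (λ k A≡0 → cong (_* h k) A≡0)) (sum-cong-≗ (λ u → cong (_* h (nb u)) (nb-sign u)))

  closedWeight : Fin n → ℤ
  closedWeight k = δ i k + + ∣ A G i k ∣

  closedWeight-cases : ∀ k → closedWeight k ≡ 1ℤ ⊎ (closedWeight k ≡ 0ℤ × k ≢ i × A G i k ≡ 0ℤ)
  closedWeight-cases k with k Fin.≟ i
  ... | yes refl = inj₁ (cong₂ _+_ (δ-diag i) (cong (λ z → + ∣ z ∣) (loopless G i)))
  ... | no k≢i with δ-off (k≢i ∘ sym) | entry G i k
  ...   | δ≡0 | inj₁ A≡0         = inj₂ (cong₂ _+_ δ≡0 (cong (λ z → + ∣ z ∣) A≡0) , k≢i , A≡0)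
  ...   | δ≡0 | inj₂ (inj₁ A≡1)  = inj₁ (cong₂ _+_ δ≡0 (cong (λ z → + ∣ z ∣) A≡1))
  ...   | δ≡0 | inj₂ (inj₂ A≡-1) = inj₁ (cong₂ _+_ δ≡0 (cong (λ z → + ∣ z ∣) A≡-1))

  sum-closedWeight : ∀ h → sum (λ k → closedWeight k * h k) ≡ h i + sum (h ∘ nb)
  sum-closedWeight h = begin
    sum (λ k → closedWeight k * h k)                                ≡⟨ sum-cong-≗ (λ k → *-distribʳ-+ (h k) (δ i k) _) ⟩
    sum (λ k → δ i k * h k + + ∣ A G i k ∣ * h k)                  ≡⟨ ∑-distrib-+ (λ k → δ i k * h k) (λ k → + ∣ A G i k ∣ * h k) ⟩
    sum (λ k → δ i k * h k) + sum (λ k → + ∣ A G i k ∣ * h k)      ≡⟨ cong₂ _+_ (sum-δ i h) (sum-nb _ (λ k A≡0 → cong (λ z → + ∣ z ∣ * h k) A≡0)) ⟩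
    h i + sum (λ u → + ∣ A G i (nb u) ∣ * h (nb u))                ≡⟨ cong (_+_ (h i)) (sum-cong-≗ unit) ⟩
    h i + sum (h ∘ nb) ∎
    where
    unit : ∀ u → + ∣ A G i (nb u) ∣ * h (nb u) ≡ h (nb u)
    unit u = trans (cong (λ z → + ∣ z ∣ * h (nb u)) (nb-sign u)) (trans (cong (_* h (nb u)) (σ-abs u)) (*-identityˡ _))

  sum-closedNeighbourhood : ∀ h → (∀ k → k ≢ i → A G i k ≡ 0ℤ → h k ≡ 0ℤ) → sum h ≡ h i + sum (h ∘ nb)
  sum-closedNeighbourhood h vanish = trans (sum-cong-≗ (λ k → sym (weighted k))) (sum-closedWeight h)
    where
    weighted : ∀ k → closedWeight k * h k ≡ h k
    weighted k with closedWeight-cases k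
    ... | inj₁ w≡1                = trans (cong (_* h k) w≡1) (*-identityˡ (h k))
    ... | inj₂ (w≡0 , k≢i , A≡0) = trans (cong (_* h k) w≡0) (sym (vanish k k≢i A≡0))

  sum-closedNeighbourhood-≤ : ∀ h → (∀ k → 0ℤ ≤ h k) → h i + sum (h ∘ nb) ≤ sum h
  sum-closedNeighbourhood-≤ h h≥0 = subst (_≤ sum h) (sum-closedWeight h) (sum-mono-≤ weighted)
    where
    weighted : ∀ k → closedWeight k * h k ≤ h k
    weighted k with closedWeight-cases k
    ... | inj₁ w≡1          = ≤-reflexive (trans (cong (_* h k) w≡1) (*-identityˡ (h k)))
    ... | inj₂ (w≡0 , _ , _) = subst (_≤ h k) (sym (cong (_* h k) w≡0)) (h≥0 k)

-- The signed graph induced on a neighbourhood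

rowTarget : ℤ → ℤ → Fin 5 → ℤ
rowTarget a b = lookup (a ∷ a ∷ a ∷ b ∷ b ∷ [])

edgeValue-σ : ∀ a b c u → edgeValue a b c (σ u) ≡ rowTarget a b u
edgeValue-σ a b c = λ { 0F → refl ; 1F → refl ; 2F → refl ; 3F → refl ; 4F → refl }

-- The row sums are the entries (A²)ᵢᵥ at the neighbours v of i; the bound says that a neighbour,
-- having exactly three positive edges, has at most that many into the closed neighbourhood of i.
Admissible : ℤ → ℤ → (Fin 5 → Fin 5 → ℤ) → Set
Admissible a b M = ∀ u → dot σ (λ v → M v u) ≡ rowTarget a b u
                       × twicePositivePart (σ u) + sum (λ v → twicePositivePart (M u v)) ≤ + 6

-- Twice the number of edges of M between neighbours of equal sign, minus twice those between opposite signs.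
edgeBalance : (Fin 5 → Fin 5 → ℤ) → ℤ
edgeBalance M = quadForm σ (λ u v → M u v * M u v)

module LocalConfiguration {n} {G : SignedGraph n} {a b c}
  (srg : StronglyRegular G 5 a b c) (regular : Regular G 5) (netRegular : NetRegular G 1ℤ) (i : Fin n) where

  open StronglyRegular srg using (diag)
  open Neighbourhood (neighbourhood G regular netRegular i)
  open NeighbourhoodSums (neighbourhood G regular netRegular i)

  L : Fin 5 → Fin 5 → ℤ
  L u v = A G (nb u) (nb v)

  Γ : Fin 5 → Fin 5 → ℤ
  Γ u v = A² G (nb u) (nb v)

  A²ᵢ-nb : ∀ u → A² G i (nb u) ≡ rowTarget a b u
  A²ᵢ-nb u = trans (A²-offDiagonal srg (i≢nb u)) (trans (cong (edgeValue a b c) (nb-sign u)) (edgeValue-σ a b c u))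

  L-row : ∀ u → dot σ (λ v → L v u) ≡ rowTarget a b u
  L-row u = begin
    dot σ (λ v → L v u)                   ≡⟨ sum-A* (λ k → A G k (nb u)) ⟨
    sum (λ k → A G i k * A G k (nb u))    ≡⟨ A²≡sum G i (nb u) ⟨
    A² G i (nb u)                         ≡⟨ A²ᵢ-nb u ⟩
    rowTarget a b u ∎

  L-degree : ∀ u → twicePositivePart (σ u) + sum (λ v → twicePositivePart (L u v)) ≤ + 6
  L-degree u =
    subst (_≤ + 6) (cong (λ z → twicePositivePart z + sum (h ∘ nb)) (trans (symm G (nb u) i) (nb-sign u)))
      (≤-trans (sum-closedNeighbourhood-≤ h (λ k → twicePositivePart-nonneg (A G (nb u) k)))
               (≤-reflexive (sum-twicePositivePart G regular netRegular (nb u))))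
    where
    h : Fin n → ℤ
    h k = twicePositivePart (A G (nb u) k)

  L-sign : ∀ u v → IsSign (L u v)
  L-sign u v = entry G (nb u) (nb v)

  L-symmetric : ∀ u v → L u v ≡ L v u
  L-symmetric u v = symm G (nb u) (nb v)

  L-loopless : ∀ u → L u u ≡ 0ℤ
  L-loopless u = loopless G (nb u)

  L-admissible : Admissible a b L
  L-admissible u = L-row u , L-degree u

  sum-A²ᵢ[A²ᵢ-c] : sum (λ j → A² G i j * (A² G i j - c)) ≡ + 5 * (+ 5 - c) + dot (rowTarget a b) (λ u → rowTarget a b u - c)
  sum-A²ᵢ[A²ᵢ-c] = begin
    sum (λ j → f j)                    ≡⟨ sum-closedNeighbourhood f vanish ⟩
    f i + sum (f ∘ nb)                 ≡⟨ cong₂ _+_ (cong (λ t → t * (t - c)) (diag i)) (sum-cong-≗ (λ u → cong (λ t → t * (t - c)) (A²ᵢ-nb u))) ⟩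
    + 5 * (+ 5 - c) + dot (rowTarget a b) (λ u → rowTarget a b u - c) ∎
    where
    f : Fin n → ℤ
    f j = A² G i j * (A² G i j - c)
    vanish : ∀ j → j ≢ i → A G i j ≡ 0ℤ → f j ≡ 0ℤ
    vanish j j≢i A≡0 = trans (cong (λ t → t * (t - c)) (StronglyRegular.nonadj srg i j (j≢i ∘ sym) A≡0)) (c*[c-c]≡0 c)
      where c*[c-c]≡0 : ∀ c → c * (c - c) ≡ 0ℤ
            c*[c-c]≡0 = solve-∀

  sum-A²ᵢ² : sum (λ j → A² G i j * A² G i j) ≡ quadForm σ Γ
  sum-A²ᵢ² = begin
    sum (λ j → A² G i j * A² G i j)                          ≡⟨ sum-A²-squares G i ⟩
    sum (λ k → A G i k * sum (λ l → A G i l * A² G k l))     ≡⟨ sum-A* (λ k → sum (λ l → A G i l * A² G k l)) ⟩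
    dot σ (λ u → sum (λ l → A G i l * A² G (nb u) l))        ≡⟨ sum-cong-≗ (λ u → cong (σ u *_) (sum-A* (A² G (nb u)))) ⟩
    quadForm σ Γ ∎

  quadForm-Γ : quadForm σ Γ - c ≡ + 5 * (+ 5 - c) + dot (rowTarget a b) (λ u → rowTarget a b u - c)
  quadForm-Γ = begin
    quadForm σ Γ - c                                      ≡⟨ cong₂ _+_ sum-A²ᵢ² (trans (cong (- c *_) (sum-A²-row G netRegular i)) (*-identityʳ (- c))) ⟨
    sum (λ j → Aᵢ² j * Aᵢ² j) + - c * sum Aᵢ²           ≡⟨ cong (_+_ (sum (λ j → Aᵢ² j * Aᵢ² j))) (*-distribˡ-sum (- c) Aᵢ²) ⟩
    sum (λ j → Aᵢ² j * Aᵢ² j) + sum (λ j → - c * Aᵢ² j) ≡⟨ ∑-distrib-+ (λ j → Aᵢ² j * Aᵢ² j) (λ j → - c * Aᵢ² j) ⟨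
    sum (λ j → Aᵢ² j * Aᵢ² j + - c * Aᵢ² j)             ≡⟨ sum-cong-≗ (λ j → expand (Aᵢ² j) c) ⟨
    sum (λ j → Aᵢ² j * (Aᵢ² j - c))                      ≡⟨ sum-A²ᵢ[A²ᵢ-c] ⟩
    + 5 * (+ 5 - c) + dot (rowTarget a b) (λ u → rowTarget a b u - c) ∎
    where
    Aᵢ² = A² G i
    expand : ∀ t c → t * (t - c) ≡ t * t + - c * t
    expand = solve-∀

  -- 2 (A²)ₖₗ as a polynomial in Aₖₗ ∈ {0, ±1}; the δ term accounts for the diagonal (A²)ₖₖ = 5.
  expansion : ℤ → ℤ → ℤ
  expansion l d = + 2 * c + (a + b - + 2 * c) * (l * l) + (a - b) * l + (+ 10 - + 2 * c) * d

  twice-Γ : ∀ u v → + 2 * Γ u v ≡ expansion (L u v) (δ u v)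
  twice-Γ u v = byCases (u Fin.≟ v)
    where
    byCases : Dec (u ≡ v) → + 2 * Γ u v ≡ expansion (L u v) (δ u v)
    byCases (yes refl) = begin
      + 2 * Γ u u                  ≡⟨ cong (+ 2 *_) (diag (nb u)) ⟩
      + 2 * + 5                    ≡⟨ diagonal a b c ⟩
      expansion 0ℤ 1ℤ              ≡⟨ cong₂ expansion (loopless G (nb u)) (δ-diag u) ⟨
      expansion (L u u) (δ u u) ∎
      where diagonal : ∀ a b c → + 2 * + 5 ≡ + 2 * c + (a + b - + 2 * c) * (0ℤ * 0ℤ) + (a - b) * 0ℤ + (+ 10 - + 2 * c) * 1ℤ
            diagonal = solve-∀
    byCases (no u≢v) = begin
      + 2 * Γ u v                               ≡⟨ cong (+ 2 *_) (A²-offDiagonal srg (u≢v ∘ nb-injective)) ⟩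
      + 2 * edgeValue a b c (L u v)             ≡⟨ twice-edgeValue a b c (L-sign u v) ⟩
      offDiagonal                               ≡⟨ +-identityʳ offDiagonal ⟨
      offDiagonal + 0ℤ                          ≡⟨ cong (_+_ offDiagonal) (*-zeroʳ (+ 10 - + 2 * c)) ⟨
      expansion (L u v) 0ℤ                      ≡⟨ cong (expansion (L u v)) (δ-off u≢v) ⟨
      expansion (L u v) (δ u v) ∎
      where offDiagonal = + 2 * c + (a + b - + 2 * c) * (L u v * L u v) + (a - b) * L u v

  quadForm-L : quadForm σ L ≡ + 3 * a - + 2 * b
  quadForm-L = begin
    quadForm σ L           ≡⟨ sum-cong-≗ (λ u → cong (σ u *_) (trans (sum-cong-≗ (λ v → cong (σ v *_) (symm G (nb u) (nb v)))) (L-row u))) ⟩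
    dot σ (rowTarget a b)  ≡⟨ signed-targets a b ⟩
    + 3 * a - + 2 * b ∎
    where
    signed-targets : ∀ a b → 1ℤ * a + (1ℤ * a + (1ℤ * a + (-1ℤ * b + (-1ℤ * b + 0ℤ)))) ≡ + 3 * a - + 2 * b
    signed-targets = solve-∀

  twice-quadForm-Γ : + 2 * quadForm σ Γ ≡
                     + 2 * c + (a + b - + 2 * c) * edgeBalance L + (a - b) * (+ 3 * a - + 2 * b) + (+ 10 - + 2 * c) * + 5
  twice-quadForm-Γ = begin
    + 2 * quadForm σ Γ                                      ≡⟨ quadForm-* σ Γ (+ 2) ⟨
    quadForm σ (λ u v → + 2 * Γ u v)                        ≡⟨ quadForm-cong σ twice-Γ ⟩
    quadForm σ (λ u v → expansion (L u v) (δ u v))          ≡⟨ quadForm-+ σ (λ u v → X₁ u v + X₂ u v + X₃ u v) X₄ ⟩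
    quadForm σ (λ u v → X₁ u v + X₂ u v + X₃ u v) + Q X₄    ≡⟨ cong (_+ Q X₄) (quadForm-+ σ (λ u v → X₁ u v + X₂ u v) X₃) ⟩
    Q (λ u v → X₁ u v + X₂ u v) + Q X₃ + Q X₄               ≡⟨ cong (λ q → q + Q X₃ + Q X₄) (quadForm-+ σ X₁ X₂) ⟩
    Q X₁ + Q X₂ + Q X₃ + Q X₄                               ≡⟨ cong₂ _+_ (cong₂ _+_ (cong₂ _+_ (quadForm-σ-const (+ 2 * c))
                                                                                             (quadForm-* σ (λ u v → L u v * L u v) (a + b - + 2 * c)))
                                                                                 (trans (quadForm-* σ L (a - b)) (cong ((a - b) *_) quadForm-L)))
                                                                     (quadForm-* σ δ (+ 10 - + 2 * c)) ⟩
    + 2 * c + (a + b - + 2 * c) * edgeBalance L + (a - b) * (+ 3 * a - + 2 * b) + (+ 10 - + 2 * c) * + 5 ∎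
    where
    Q = quadForm σ
    X₁ X₂ X₃ X₄ : Fin 5 → Fin 5 → ℤ
    X₁ u v = + 2 * c
    X₂ u v = (a + b - + 2 * c) * (L u v * L u v)
    X₃ u v = (a - b) * L u v
    X₄ u v = (+ 10 - + 2 * c) * δ u v

  edgeBalance-equation : (a + b - + 2 * c) * (edgeBalance L - (+ 3 * a + + 2 * b)) ≡ 0ℤ
  edgeBalance-equation = begin
    (a + b - + 2 * c) * (edgeBalance L - (+ 3 * a + + 2 * b)) ≡⟨ algebra a b c (quadForm σ Γ) (edgeBalance L) ⟩
    (E - + 2 * quadForm σ Γ) + + 2 * (quadForm σ Γ - c - R)  ≡⟨ cong₂ (λ x y → (E - x) + + 2 * (y - R)) twice-quadForm-Γ quadForm-Γ ⟩
    (E - E) + + 2 * (R - R)                             ≡⟨ cong₂ (λ x y → x + + 2 * y) (+-inverseʳ E) (+-inverseʳ R) ⟩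
    0ℤ ∎
    where
    E = + 2 * c + (a + b - + 2 * c) * edgeBalance L + (a - b) * (+ 3 * a - + 2 * b) + (+ 10 - + 2 * c) * + 5
    R = + 5 * (+ 5 - c) + dot (rowTarget a b) (λ u → rowTarget a b u - c)
    algebra : ∀ a b c q D → (a + b - + 2 * c) * (D - (+ 3 * a + + 2 * b)) ≡
      (+ 2 * c + (a + b - + 2 * c) * D + (a - b) * (+ 3 * a - + 2 * b) + (+ 10 - + 2 * c) * + 5 - + 2 * q)
      + + 2 * (q - c - (+ 5 * (+ 5 - c) + (a * (a - c) + (a * (a - c) + (a * (a - c) + (b * (b - c) + (b * (b - c) + 0ℤ)))))))
    algebra = solve-∀

-- Exhaustive search over the induced graphs

symmetricOf : Vec ℤ 10 → Fin 5 → Fin 5 → ℤ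
symmetricOf (e₀₁ ∷ e₀₂ ∷ e₀₃ ∷ e₀₄ ∷ e₁₂ ∷ e₁₃ ∷ e₁₄ ∷ e₂₃ ∷ e₂₄ ∷ e₃₄ ∷ []) u v = lookup (lookup rows u) v
  where
  rows = (0ℤ  ∷ e₀₁ ∷ e₀₂ ∷ e₀₃ ∷ e₀₄ ∷ [])
       ∷ (e₀₁ ∷ 0ℤ  ∷ e₁₂ ∷ e₁₃ ∷ e₁₄ ∷ [])
       ∷ (e₀₂ ∷ e₁₂ ∷ 0ℤ  ∷ e₂₃ ∷ e₂₄ ∷ [])
       ∷ (e₀₃ ∷ e₁₃ ∷ e₂₃ ∷ 0ℤ  ∷ e₃₄ ∷ [])
       ∷ (e₀₄ ∷ e₁₄ ∷ e₂₄ ∷ e₃₄ ∷ 0ℤ  ∷ []) ∷ []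

upperEntries : (Fin 5 → Fin 5 → ℤ) → Vec ℤ 10
upperEntries M = M 0F 1F ∷ M 0F 2F ∷ M 0F 3F ∷ M 0F 4F ∷ M 1F 2F ∷ M 1F 3F ∷ M 1F 4F ∷ M 2F 3F ∷ M 2F 4F ∷ M 3F 4F ∷ []

symmetricOf-upperEntries : ∀ {M} → (∀ u v → M u v ≡ M v u) → (∀ u → M u u ≡ 0ℤ) →
                           ∀ u v → symmetricOf (upperEntries M) u v ≡ M u v
symmetricOf-upperEntries {M} sym-M diag-M = λ
  { 0F 0F → sym (diag-M 0F) ; 0F 1F → refl            ; 0F 2F → refl            ; 0F 3F → refl            ; 0F 4F → refl
  ; 1F 0F → sym-M 0F 1F     ; 1F 1F → sym (diag-M 1F) ; 1F 2F → refl            ; 1F 3F → refl            ; 1F 4F → refl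
  ; 2F 0F → sym-M 0F 2F     ; 2F 1F → sym-M 1F 2F     ; 2F 2F → sym (diag-M 2F) ; 2F 3F → refl            ; 2F 4F → refl
  ; 3F 0F → sym-M 0F 3F     ; 3F 1F → sym-M 1F 3F     ; 3F 2F → sym-M 2F 3F     ; 3F 3F → sym (diag-M 3F) ; 3F 4F → refl
  ; 4F 0F → sym-M 0F 4F     ; 4F 1F → sym-M 1F 4F     ; 4F 2F → sym-M 2F 4F     ; 4F 3F → sym-M 3F 4F     ; 4F 4F → sym (diag-M 4F)
  }

Admissible-cong : ∀ {a b M M′} → (∀ u v → M u v ≡ M′ u v) → Admissible a b M → Admissible a b M′
Admissible-cong M≡M′ adm u =
    trans (sum-cong-≗ (λ v → cong (σ v *_) (sym (M≡M′ v u)))) (proj₁ (adm u))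
  , subst (λ s → twicePositivePart (σ u) + s ≤ + 6) (sum-cong-≗ (λ v → cong twicePositivePart (M≡M′ u v))) (proj₂ (adm u))

admissibleRow : ℤ → ℤ → (Fin 5 → Fin 5 → ℤ) → Fin 5 → Bool
admissibleRow a b M u = isYes (dot σ (λ v → M v u) ≟ rowTarget a b u)
                      ∧ (twicePositivePart (σ u) + sum (λ v → twicePositivePart (M u v)) ≤ᵇ + 6)

Admissible⇒admissibleRow : ∀ {a b M} → Admissible a b M → ∀ u → T (admissibleRow a b M u)
Admissible⇒admissibleRow adm u =
  Equivalence.from T-∧ (fromWitness (proj₁ (adm u)) , ≤⇒≤ᵇ (proj₂ (adm u)))

infixr 0 _⇒ᵇ_
_⇒ᵇ_ : Bool → Bool → Bool
true  ⇒ᵇ y = y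
false ⇒ᵇ _ = true

T-⇒ᵇ : ∀ {x y} → T (x ⇒ᵇ y) → T x → T y
T-⇒ᵇ {true} holds _ = holds

signs : List ℤ
signs = 0ℤ ∷ 1ℤ ∷ -1ℤ ∷ []

IsSign⇒∈signs : ∀ {z} → IsSign z → z ∈ signs
IsSign⇒∈signs (inj₁ refl)        = here refl
IsSign⇒∈signs (inj₂ (inj₁ refl)) = there (here refl)
IsSign⇒∈signs (inj₂ (inj₂ refl)) = there (there (here refl))

allSignVectors : ∀ m → (Vec ℤ m → Bool) → Bool
allSignVectors zero    p = p []
allSignVectors (suc m) p = all (λ z → allSignVectors m (p ∘ (z ∷_))) signs

allSignVectors-sound : ∀ {m} p → T (allSignVectors m p) → ∀ {E} → Vec.All IsSign E → T (p E)
allSignVectors-sound p holds Vec.[]                 = holds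
allSignVectors-sound {suc m} p holds (z-sign Vec.∷ E-signs) =
  allSignVectors-sound (p ∘ (_ ∷_)) (All.lookup (all⁺ (λ z → allSignVectors m (p ∘ (z ∷_))) signs holds) (IsSign⇒∈signs z-sign)) E-signs

-- Vertex u of symmetricOf E only involves the first u + 1 rows of the upper triangle E, so its
-- constraints are tested as soon as those rows are chosen (the other entries are padded with 0).
module _ (a b : ℤ) where

  private
    row : Fin 5 → Vec ℤ 10 → Bool
    row u E = admissibleRow a b (symmetricOf E) u

  afterRow₃ : Vec ℤ 4 → Vec ℤ 3 → Vec ℤ 2 → Vec ℤ 1 → Bool
  afterRow₃ r₀ r₁ r₂ r₃ = row 3F E ⇒ᵇ row 4F E ⇒ᵇ isNo (edgeBalance (symmetricOf E) ≟ + 3 * a + + 2 * b)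
    where E = r₀ ++ᵛ r₁ ++ᵛ r₂ ++ᵛ r₃

  afterRow₂ : Vec ℤ 4 → Vec ℤ 3 → Vec ℤ 2 → Bool
  afterRow₂ r₀ r₁ r₂ = row 2F (r₀ ++ᵛ r₁ ++ᵛ r₂ ++ᵛ replicate 1 0ℤ) ⇒ᵇ allSignVectors 1 (afterRow₃ r₀ r₁ r₂)

  afterRow₁ : Vec ℤ 4 → Vec ℤ 3 → Bool
  afterRow₁ r₀ r₁ = row 1F (r₀ ++ᵛ r₁ ++ᵛ replicate 3 0ℤ) ⇒ᵇ allSignVectors 2 (afterRow₂ r₀ r₁)

  afterRow₀ : Vec ℤ 4 → Bool
  afterRow₀ r₀ = row 0F (r₀ ++ᵛ replicate 6 0ℤ) ⇒ᵇ allSignVectors 3 (afterRow₁ r₀)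

  noAdmissibleConfiguration : Bool
  noAdmissibleConfiguration = allSignVectors 4 afterRow₀

noAdmissibleConfiguration-sound :
  ∀ {a b} → T (noAdmissibleConfiguration a b) → ∀ {E} → Vec.All IsSign E →
  (∀ u → T (admissibleRow a b (symmetricOf E) u)) → edgeBalance (symmetricOf E) ≢ + 3 * a + + 2 * b
noAdmissibleConfiguration-sound {a} {b} holds
  {e₀₁ ∷ e₀₂ ∷ e₀₃ ∷ e₀₄ ∷ e₁₂ ∷ e₁₃ ∷ e₁₄ ∷ e₂₃ ∷ e₂₄ ∷ e₃₄ ∷ []}
  (s₀₁ Vec.∷ s₀₂ Vec.∷ s₀₃ Vec.∷ s₀₄ Vec.∷ s₁₂ Vec.∷ s₁₃ Vec.∷ s₁₄ Vec.∷ s₂₃ Vec.∷ s₂₄ Vec.∷ s₃₄ Vec.∷ Vec.[]) row =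
  toWitnessFalse
    (T-⇒ᵇ (T-⇒ᵇ (allSignVectors-sound (afterRow₃ a b r₀ r₁ r₂) third (s₃₄ Vec.∷ Vec.[])) (row 3F)) (row 4F))
  where
  r₀ = e₀₁ ∷ e₀₂ ∷ e₀₃ ∷ e₀₄ ∷ []
  r₁ = e₁₂ ∷ e₁₃ ∷ e₁₄ ∷ []
  r₂ = e₂₃ ∷ e₂₄ ∷ []
  first  = T-⇒ᵇ (allSignVectors-sound (afterRow₀ a b) holds (s₀₁ Vec.∷ s₀₂ Vec.∷ s₀₃ Vec.∷ s₀₄ Vec.∷ Vec.[])) (row 0F)
  second = T-⇒ᵇ (allSignVectors-sound (afterRow₁ a b r₀) first (s₁₂ Vec.∷ s₁₃ Vec.∷ s₁₄ Vec.∷ Vec.[])) (row 1F)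
  third  = T-⇒ᵇ (allSignVectors-sound (afterRow₂ a b r₀ r₁) second (s₂₃ Vec.∷ s₂₄ Vec.∷ Vec.[])) (row 2F)

noConfiguration : ∀ {a b} → T (noAdmissibleConfiguration a b) →
                  ∀ {M} → (∀ u v → IsSign (M u v)) → (∀ u v → M u v ≡ M v u) → (∀ u → M u u ≡ 0ℤ) →
                  Admissible a b M → edgeBalance M ≢ + 3 * a + + 2 * b
noConfiguration {a} {b} holds {M} sign sym-M diag-M adm balance≡ =
  noAdmissibleConfiguration-sound {a} {b} holds E-signs
    (Admissible⇒admissibleRow {a} {b} {symmetricOf E} (Admissible-cong {a} {b} {M} {symmetricOf E} (λ u v → sym (M′≡M u v)) adm))
    (trans (quadForm-cong σ (λ u v → cong₂ _*_ (M′≡M u v) (M′≡M u v))) balance≡)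
  where
  E = upperEntries M
  M′≡M = symmetricOf-upperEntries sym-M diag-M
  E-signs : Vec.All IsSign E
  E-signs = sign 0F 1F Vec.∷ sign 0F 2F Vec.∷ sign 0F 3F Vec.∷ sign 0F 4F Vec.∷ sign 1F 2F Vec.∷ sign 1F 3F Vec.∷
            sign 1F 4F Vec.∷ sign 2F 3F Vec.∷ sign 2F 4F Vec.∷ sign 3F 4F Vec.∷ Vec.[]

i*j≡0⇒j≡0 : ∀ {x y} → x ≢ 0ℤ → x * y ≡ 0ℤ → y ≡ 0ℤ
i*j≡0⇒j≡0 {x} x≢0 xy≡0 with i*j≡0⇒i≡0∨j≡0 x xy≡0
... | inj₁ x≡0 = contradiction x≡0 x≢0
... | inj₂ y≡0 = y≡0

a+b-2c≢0 : ∀ {n} {G : SignedGraph n} {a b c} → Class₁ G a b c ⊎ Class₄ G a b c ⊎ Class₅ G a b c →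
           a ≢ - b → a + b - + 2 * c ≢ 0ℤ
a+b-2c≢0 (inj₁ (_ , a≡-b , _))                   a≢-b _    = a≢-b a≡-b
a+b-2c≢0 {a = a} {b} (inj₂ (inj₁ (_ , _ , _ , refl))) a≢-b β≡0 =
  a≢-b (i-j≡0⇒i≡j a (- b) (trans (cong (_+_ a) (neg-involutive b)) (trans (sym (+-identityʳ (a + b))) β≡0)))
a+b-2c≢0 (inj₂ (inj₂ (_ , _ , _ , 2c≢a+b , _))) _    β≡0 = 2c≢a+b (sym (i-j≡0⇒i≡j _ _ β≡0))

ruledOut : ∀ {n} {G : SignedGraph n} {a b c} a₀ b₀ →
           noAdmissibleConfiguration a₀ b₀ ≡ true → a₀ ≢ - b₀ →
           StronglyRegular G 5 a b c → Class₁ G a b c ⊎ Class₄ G a b c ⊎ Class₅ G a b c →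
           Regular G 5 → NetRegular G 1ℤ → Fin n → ¬ (a ≡ a₀ × b ≡ b₀)
ruledOut {G = G} {c = c} a₀ b₀ checked a₀≢-b₀ srg classes regular netRegular i (refl , refl) =
  noConfiguration (Equivalence.from T-≡ checked) {L} L-sign L-symmetric L-loopless L-admissible balance≡
  where
  open LocalConfiguration srg regular netRegular i
  balance≡ : edgeBalance L ≡ + 3 * a₀ + + 2 * b₀
  balance≡ = i-j≡0⇒i≡j (edgeBalance L) (+ 3 * a₀ + + 2 * b₀) (i*j≡0⇒j≡0 (a+b-2c≢0 {G = G} classes a₀≢-b₀) edgeBalance-equation)
lemma3p8 : (n : ℕ) (G : SignedGraph n) (a b c : ℤ)
    → StronglyRegular G 5 a b c
    → Class₁ G a b c ⊎ Class₄ G a b c ⊎ Class₅ G a b c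
    → Connected G
    → ¬ Complete G
    → Regular G 5
    → NetRegular G (+ 1)
    → ¬ (a ≡ + 0 × b ≡ + 2) × ¬ (a ≡ - (+ 2) × b ≡ + 0)
lemma3p8 zero    G a b c srg _       _ _ _       _          = ⊥-elim (StronglyRegular.notEdgeless srg (λ ()))
lemma3p8 (suc m) G a b c srg classes _ _ regular netRegular =
    ruledOut 0ℤ (+ 2) refl (λ ()) srg classes regular netRegular zero
  , ruledOut (- (+ 2)) 0ℤ refl (λ ()) srg classes regular netRegular zero
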